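{- Let $G=(V,E)$ be a finite undirected graph with $n=|V|$, let $\pi\colon V\to\{1,\dots,n\}$ be a bijective vertex order, and let $G^*$ be the resulting CCH graph. If $L^*$ is the canonical HCuHL respecting $\pi$, then for every vertex $v\in V$ we have $L^*(v)=\mathit{SS}(v)$, where $\mathit{SS}(v)$ denotes the search space of $v$ in $G^*$.
   Context: The CCH graph of $G$ with respect to $\pi$ is $G^*=(V,E\cup E^+)$, where a shortcut edge $\{v,w\}$ belongs to $E\cup E^+$ if and only if there exists a simple $v$-$w$-path in $G$ all of whose vertices $u$ other than $v,w$ satisfy $\pi(u)<\min\{\pi(v),\pi(w)\}$ (so all edges of $G$ are present). The search space $\mathit{SS}(v)$ is the set of vertices reachable from $v$ in $G^*$ along a path whose vertex ranks are increasing with respect to $\pi$ (including $v$ itself). The canonical HCuHL respecting $\pi$ is the labeling $L^*\colon V\to 2^V$ with $u\in L^*(v)$ if and only if there is some $v$-$u$-path in $G$ on which $u$ has maximum rank. -}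

module Defs where

open import Data.Nat using (ℕ)
open import Data.Fin using (Fin; _<_; _≤_)
open import Data.List using (List; []; _∷_)
open import Data.List.Relation.Unary.All using (All)
open import Data.List.Relation.Unary.Unique.Propositional using (Unique)
open import Data.Product using (_×_; ∃)
open import Relation.Binary.PropositionalEquality using (_≡_; _≢_)
open import Relation.Nullary using (¬_)
open import Function.Definitions using (Bijective)

record Graph (n : ℕ) : Set₁ where
  field
    Adj   : Fin n → Fin n → Set
    sym   : ∀ {v w} → Adj v w → Adj w v
    irrefl : ∀ {v} → ¬ Adj v v

-- A bijective vertex order π : V → {1..n}, represented as a bijection Fin n → Fin n
-- (rank i+1 is represented by i; only the order matters).
Order : ℕ → Set
Order n = Fin n → Fin n

IsVertexOrder : ∀ {n} → Order n → Set
IsVertexOrder π = Bijective _≡_ _≡_ π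

data Walk {n : ℕ} (R : Fin n → Fin n → Set) : Fin n → Fin n → Set where
  []  : ∀ {v} → Walk R v v
  _∷_ : ∀ {v u w} → R v u → Walk R u w → Walk R v w

vertices : ∀ {n} {R : Fin n → Fin n → Set} {v w} → Walk R v w → List (Fin n)
vertices {v = v} []       = v ∷ []
vertices {v = v} (e ∷ p) = v ∷ vertices p

interior : ∀ {n} {R : Fin n → Fin n → Set} {v w} → Walk R v w → List (Fin n)
interior []            = []
interior (e ∷ [])      = []
interior (e ∷ (_∷_ {v = u} f p)) = u ∷ interior (f ∷ p)

Simple : ∀ {n} {R : Fin n → Fin n → Set} {v w} → Walk R v w → Set
Simple p = Unique (vertices p)

module _ {n : ℕ} (G : Graph n) (π : Order n) where
  open Graph G

  -- Edges of the CCH graph G* = (V, E ∪ E⁺): {v,w} (v ≠ w) is an edge iff there is a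
  -- simple v-w-path in G all of whose interior vertices have rank below min(π v, π w).
  CCHEdge : Fin n → Fin n → Set
  CCHEdge v w = v ≢ w × ∃ λ (p : Walk Adj v w) →
    Simple p × All (λ u → π u < π v × π u < π w) (interior p)

  UpEdge : Fin n → Fin n → Set
  UpEdge v w = CCHEdge v w × π v < π w

  SS : Fin n → Fin n → Set
  SS v u = Walk UpEdge v u

  L* : Fin n → Fin n → Set
  L* v u = ∃ λ (p : Walk Adj v u) → Simple p × All (λ x → π x ≤ π u) (vertices p)

-- Read off the rank sequence of a simple v-u-path on which u has maximum rank at its
-- successive records v = w₀, w₁, …, wₖ = u (each wᵢ₊₁ is the first vertex after wᵢ of
-- higher rank).  The stretch between two records has interior below both, so it is a
-- shortcut, and the records form an upward path in G*.  Conversely, unfolding every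
-- upward shortcut of a search-space path into its underlying path of G yields a walk on
-- which u has maximum rank, and erasing its loops makes it simple.
module Submission where

open import Defs
open import Data.Nat using (ℕ; suc)
open import Data.Fin using (Fin; _≟_; _<_; _≤_; _<?_)
open import Function.Bundles using (_⇔_)

import Data.Nat as ℕ
import Data.Nat.Properties as ℕ
open import Data.Nat.Induction using (<-wellFounded)
open import Data.Fin.Properties using (<-irrefl; <-trans; ≤-refl; ≤∧≢⇒<)
open import Data.List.Relation.Unary.All as All using (All; []; _∷_)
open import Data.List.Relation.Unary.All.Properties using (¬Any⇒All¬)
open import Data.List.Relation.Unary.Any as Any using (Any; here; there)
open import Data.List.Relation.Unary.AllPairs using ([]; _∷_)
open import Data.List.Membership.Propositional using (_∈_)
import Data.List.Membership.DecPropositional as DecMembership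
open import Data.List.Relation.Binary.Subset.Propositional using (_⊆_)
open import Data.List.Relation.Binary.Subset.Propositional.Properties using (All-resp-⊇; ∷⁺ʳ)
open import Data.Product using (_×_; ∃; Σ; _,_; proj₁; proj₂)
open import Data.Empty using (⊥-elim)
open import Induction.WellFounded using (Acc; acc)
open import Relation.Binary.PropositionalEquality using (_≡_; _≢_; refl; sym)
open import Relation.Nullary using (¬_; yes; no)
open import Relation.Unary using (Decidable; ∁)
open import Function.Base using (id)
open import Function.Bundles using (mk⇔)
open import Function.Definitions using (Injective)

module _ {n : ℕ} {R : Fin n → Fin n → Set} where

  open DecMembership (_≟_ {n}) using (_∈?_)

  length : ∀ {v w} → Walk R v w → ℕ
  length []      = 0
  length (_ ∷ p) = suc (length p)

  infixr 5 _++_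
  _++_ : ∀ {a b c} → Walk R a b → Walk R b c → Walk R a c
  []      ++ q = q
  (e ∷ p) ++ q = e ∷ (p ++ q)

  source∈vertices : ∀ {v w} (p : Walk R v w) → v ∈ vertices p
  source∈vertices []      = here refl
  source∈vertices (_ ∷ _) = here refl

  target∈vertices : ∀ {v w} (p : Walk R v w) → w ∈ vertices p
  target∈vertices []      = here refl
  target∈vertices (_ ∷ p) = there (target∈vertices p)

  vertices-++⁺ˡ : ∀ {a b c} (p : Walk R a b) (q : Walk R b c) → vertices p ⊆ vertices (p ++ q)
  vertices-++⁺ˡ []      q (here refl) = source∈vertices q
  vertices-++⁺ˡ (_ ∷ p) q (here refl) = here refl
  vertices-++⁺ˡ (_ ∷ p) q (there x∈p) = there (vertices-++⁺ˡ p q x∈p)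

  vertices-++⁺ʳ : ∀ {a b c} (p : Walk R a b) (q : Walk R b c) → vertices q ⊆ vertices (p ++ q)
  vertices-++⁺ʳ []      q = id
  vertices-++⁺ʳ (_ ∷ p) q = λ x∈q → there (vertices-++⁺ʳ p q x∈q)

  All-vertices-++ : ∀ {P : Fin n → Set} {a b c} (p : Walk R a b) (q : Walk R b c) →
    All P (vertices p) → All P (vertices q) → All P (vertices (p ++ q))
  All-vertices-++ []      q _          Pq = Pq
  All-vertices-++ (_ ∷ p) q (Pa ∷ Pp) Pq = Pa ∷ All-vertices-++ p q Pp Pq

  Simple-++⁻ : ∀ {a b c} (p : Walk R a b) (q : Walk R b c) → Simple (p ++ q) → Simple p × Simple q
  Simple-++⁻ []      q simple = ([] ∷ []) , simple
  Simple-++⁻ (_ ∷ p) q (a∉ ∷ simple) with Simple-++⁻ p q simple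
  ... | simple-p , simple-q = (All-resp-⊇ (vertices-++⁺ˡ p q) a∉ ∷ simple-p) , simple-q

  length-++ʳ≤ : ∀ {a b c} (p : Walk R a b) (q : Walk R b c) → length q ℕ.≤ length (p ++ q)
  length-++ʳ≤ []      q = ℕ.≤-refl
  length-++ʳ≤ (_ ∷ p) q = ℕ.m≤n⇒m≤1+n (length-++ʳ≤ p q)

  length-++ʳ< : ∀ {a b c} → a ≢ b → (p : Walk R a b) (q : Walk R b c) → length q ℕ.< length (p ++ q)
  length-++ʳ< a≢a []      q = ⊥-elim (a≢a refl)
  length-++ʳ< _   (_ ∷ p) q = ℕ.s≤s (length-++ʳ≤ p q)

  interior-∷⊆ : ∀ {a b c} (e : R a b) (q : Walk R b c) → interior (e ∷ q) ⊆ vertices q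
  interior-∷⊆ e []      ()
  interior-∷⊆ e (f ∷ q) (here refl) = here refl
  interior-∷⊆ e (f ∷ q) (there x∈q) = there (interior-∷⊆ f q x∈q)

  All-interior-∷ : ∀ {P : Fin n → Set} {a b c} (e : R a b) (q : Walk R b c) →
    P b → All P (interior q) → All P (interior (e ∷ q))
  All-interior-∷ e []      _  _  = []
  All-interior-∷ e (_ ∷ _) Pb Pq = Pb ∷ Pq

  All-vertices : ∀ {P : Fin n → Set} {a b} (p : Walk R a b) →
    P a → All P (interior p) → P b → All P (vertices p)
  All-vertices []            Pa _          _  = Pa ∷ []
  All-vertices (_ ∷ [])      Pa _          Pb = Pa ∷ Pb ∷ []
  All-vertices (_ ∷ (f ∷ p)) Pa (Pc ∷ Pp) Pb = Pa ∷ All-vertices (f ∷ p) Pc Pp Pb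

  Simple⇒source∉interior : ∀ {a b} (p : Walk R a b) → Simple p → All (a ≢_) (interior p)
  Simple⇒source∉interior []      _         = []
  Simple⇒source∉interior (e ∷ q) (a∉ ∷ _) = All-resp-⊇ (interior-∷⊆ e q) a∉

  breakAt : ∀ {P : Fin n → Set} → Decidable P → ∀ {a c} (p : Walk R a c) → ¬ P a → Any P (vertices p) →
    ∃ λ b → Σ (Walk R a b) λ pre → Σ (Walk R b c) λ suf →
      p ≡ pre ++ suf × P b × All (∁ P) (interior pre)
  breakAt P? []      ¬Pa (here Pa) = ⊥-elim (¬Pa Pa)
  breakAt P? (e ∷ p) ¬Pa (here Pa) = ⊥-elim (¬Pa Pa)
  breakAt P? (_∷_ {u = b} e p) ¬Pa (there P∈p) with P? b
  ... | yes Pb = b , e ∷ [] , p , refl , Pb , []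
  ... | no ¬Pb with breakAt P? p ¬Pb P∈p
  ...   | c , pre , suf , refl , Pc , ∁P = c , e ∷ pre , suf , refl , Pc , All-interior-∷ e pre ¬Pb ∁P

  suffixFrom : ∀ {a c x} (p : Walk R a c) → x ∈ vertices p →
    Σ (Walk R x c) λ suf → (Simple p → Simple suf) × vertices suf ⊆ vertices p
  suffixFrom {a} {x = x} p x∈p with x ≟ a
  ... | yes refl = p , id , id
  ... | no x≢a with breakAt (x ≟_) p x≢a x∈p
  ...   | _ , pre , suf , refl , refl , _ =
          suf , (λ simple → Simple-++⁻ pre suf simple .proj₂) , vertices-++⁺ʳ pre suf

  eraseLoops : ∀ {a b} (p : Walk R a b) → ∃ λ (q : Walk R a b) → Simple q × vertices q ⊆ vertices p
  eraseLoops [] = [] , [] ∷ [] , id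
  eraseLoops {a} (e ∷ p) with eraseLoops p
  ... | q , simple-q , q⊆p with a ∈? vertices q
  ...   | no a∉q = e ∷ q , ¬Any⇒All¬ _ a∉q ∷ simple-q , ∷⁺ʳ a q⊆p
  ...   | yes a∈q with suffixFrom q a∈q
  ...     | suf , simple-suf , suf⊆q = suf , simple-suf simple-q , (λ x∈suf → there (q⊆p (suf⊆q x∈suf)))

module _ {n : ℕ} (G : Graph n) (π : Order n) where
  open Graph G using (Adj)

  L*⇒SS : Injective _≡_ _≡_ π → ∀ {v u} (p : Walk Adj v u) → Acc ℕ._<_ (length p) →
    Simple p → All (λ x → π x ≤ π u) (vertices p) → SS G π v u
  L*⇒SS π-injective {v} {u} p (acc smaller) simple bounded with v ≟ u
  ... | yes refl = []
  ... | no v≢u with breakAt (λ x → π v <? π x) p (<-irrefl refl) (Any.map (λ { refl → v<u }) (target∈vertices p))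
    where v<u : π v < π u
          v<u = ≤∧≢⇒< (All.lookup bounded (source∈vertices p)) (λ πv≡πu → v≢u (π-injective πv≡πu))
  ...   | w , pre , suf , refl , v<w , below =
          (shortcut , v<w) ∷ L*⇒SS π-injective suf (smaller (length-++ʳ< v≢w pre suf)) simple-suf
                                   (All-resp-⊇ (vertices-++⁺ʳ pre suf) bounded)
    where
      v≢w : v ≢ w
      v≢w refl = <-irrefl refl v<w
      simple-pre : Simple pre
      simple-pre = Simple-++⁻ pre suf simple .proj₁
      simple-suf : Simple suf
      simple-suf = Simple-++⁻ pre suf simple .proj₂
      interior-below : ∀ {x} → ¬ π v < π x × v ≢ x → π x < π v × π x < π w
      interior-below {x} (x≮v , v≢x) = x<v , <-trans x<v v<w
        where x<v : π x < π v
              x<v = ≤∧≢⇒< (ℕ.≮⇒≥ x≮v) (λ πx≡πv → v≢x (sym (π-injective πx≡πv)))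
      shortcut : CCHEdge G π v w
      shortcut = v≢w , pre , simple-pre , All.zipWith interior-below
                                              (below , Simple⇒source∉interior pre simple-pre)

  unfoldShortcuts : ∀ {v u} → SS G π v u → ∃ λ (p : Walk Adj v u) → All (λ x → π x ≤ π u) (vertices p)
  unfoldShortcuts [] = [] , ≤-refl ∷ []
  unfoldShortcuts {v} {u} ((_∷_ {u = w} ((_ , pre , _ , below) , v<w)) q) with unfoldShortcuts q
  ... | p , bounded = pre ++ p , All-vertices-++ pre p pre-bounded bounded
    where
      w≤u : π w ≤ π u
      w≤u = All.lookup bounded (source∈vertices p)
      v≤u : π v ≤ π u
      v≤u = ℕ.<⇒≤ (ℕ.<-≤-trans v<w w≤u)
      pre-bounded : All (λ x → π x ≤ π u) (vertices pre)
      pre-bounded = All-vertices pre v≤u (All.map (λ (x<v , _) → ℕ.≤-trans (ℕ.<⇒≤ x<v) v≤u) below) w≤u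

  SS⇒L* : ∀ {v u} → SS G π v u → L* G π v u
  SS⇒L* q with unfoldShortcuts q
  ... | p , bounded with eraseLoops p
  ...   | p′ , simple , p′⊆p = p′ , simple , All-resp-⊇ p′⊆p bounded

mainTheorem3 : (n : ℕ) (G : Graph n) (π : Order n) → IsVertexOrder π →
    (v u : Fin n) → L* G π v u ⇔ SS G π v u
mainTheorem3 _ G π (π-injective , _) _ _ = mk⇔
  (λ (p , simple , bounded) → L*⇒SS G π π-injective p (<-wellFounded (length p)) simple bounded)
  (SS⇒L* G π)
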